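{- For each classical implicative algebra $\mathscr{A}$, there exists an abstract Krivine structure $\mathcal{K}$ that induces the same tripos, in the sense that the classical realizability tripos induced by $\mathcal{K}$ is isomorphic to the implicative tripos induced by $\mathscr{A}$.
   Context: An implicative structure $(\mathscr{A},\preccurlyeq,\to)$ is a complete lattice (meets $\bigwedge$, bottom $\bot$) with $\to$ anti-monotonic in its first and monotonic in its second argument such that $a\to\bigwedge_{b\in B}b=\bigwedge_{b\in B}(a\to b)$ for all $B\subseteq\mathscr{A}$. A separator is an upwards closed $S\subseteq\mathscr{A}$ containing $\bigwedge_{a,b}(a\to b\to a)$ and $\bigwedge_{a,b,c}((a\to b\to c)\to(a\to b)\to a\to c)$ and closed under modus ponens; the implicative algebra $(\mathscr{A},\preccurlyeq,\to,S)$ is classical if $\bigwedge_{a,b}(((a\to b)\to a)\to a)\in S$. The implicative tripos of such an algebra is $I\mapsto\mathscr{A}^I/S[I]$, where $\mathscr{A}^I$ has componentwise order and implication, $S[I]=\{a\in\mathscr{A}^I:\exists s\in S,\forall i,\ s\preccurlyeq a_i\}$, the quotient is the poset reflection of $a\vdash b$ iff $(a\to b)\in S[I]$, and maps are induced by reindexing. An abstract Krivine structure (AKS) is $\mathcal{K}=(\Lambda,\Pi,@,\cdot,\mathtt{k}_{\_},\mathtt{K},\mathtt{S},\mathtt{cc},\mathrm{PL},\perp\!\!\!\perp)$ with nonempty sets $\Lambda$ (terms) and $\Pi$ (stacks), application $@:\Lambda^2\to\Lambda$ (written $tu$), push $\cdot:\Lambda\times\Pi\to\Pi$, $\mathtt{k}_{\_}:\Pi\to\Lambda$,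 distinguished $\mathtt{K},\mathtt{S},\mathtt{cc}\in\Lambda$, a set $\mathrm{PL}\subseteq\Lambda$ containing $\mathtt{K},\mathtt{S},\mathtt{cc}$ and closed under application, and a pole $\perp\!\!\!\perp\subseteq\Lambda\times\Pi$ closed under anti-evaluation: $(t,u\cdot\pi)\in\perp\!\!\!\perp\Rightarrow(tu,\pi)\in\perp\!\!\!\perp$; $(t,\pi)\in\perp\!\!\!\perp\Rightarrow(\mathtt{K},t\cdot u\cdot\pi)\in\perp\!\!\!\perp$; $(t,v\cdot uv\cdot\pi)\in\perp\!\!\!\perp\Rightarrow(\mathtt{S},t\cdot u\cdot v\cdot\pi)\in\perp\!\!\!\perp$; $(t,\mathtt{k}_\pi\cdot\pi)\in\perp\!\!\!\perp\Rightarrow(\mathtt{cc},t\cdot\pi)\in\perp\!\!\!\perp$; $(t,\pi)\in\perp\!\!\!\perp\Rightarrow(\mathtt{k}_\pi,t\cdot\pi')\in\perp\!\!\!\perp$. An AKS induces the classical implicative algebra with carrier $\mathfrak{P}(\Pi)$, order $a\preccurlyeq b$ iff $a\supseteq b$, implication $a\to b=\{t\cdot\pi:t\in a^{\perp\!\!\!\perp},\pi\in b\}$ where $a^{\perp\!\!\!\perp}=\{t\in\Lambda:\forall\pi\in a,(t,\pi)\in\perp\!\!\!\perp\}$, and separator $\{a:a^{\perp\!\!\!\perp}\cap\mathrm{PL}\neq\varnothing\}$; the classical realizability tripos of $\mathcal{K}$ is the implicative tripos of this algebra. Triposes are isomorphic when there is a natural isomorphism between them. -}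

module Defs where

open import Level using (Level; _⊔_; suc; Setω)
open import Data.Product using (Σ; _×_; _,_)
open import Relation.Binary.PropositionalEquality using (_≡_)
open import Relation.Binary.Structures using (IsPartialOrder)
open import Function using (_∘_)

record ImplicativeStructure (ℓ : Level) : Set (suc ℓ) where
  infixr 5 _⇒_
  infix 4 _≼_
  field
    A   : Set ℓ
    _≼_ : A → A → Set ℓ
    isPartialOrder : IsPartialOrder _≡_ _≼_
    -- complete lattice: meets of arbitrary families (subsets B ⊆ A are the
    -- families indexed by Σ A B)
    ⋀       : {I : Set ℓ} → (I → A) → A
    ⋀-lower : {I : Set ℓ} (f : I → A) (i : I) → ⋀ f ≼ f i
    ⋀-glb   : {I : Set ℓ} (f : I → A) (c : A) → ((i : I) → c ≼ f i) → c ≼ ⋀ f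
    _⇒_     : A → A → A
    ⇒-anti  : ∀ {a a' b} → a' ≼ a → (a ⇒ b) ≼ (a' ⇒ b)
    ⇒-mono  : ∀ {a b b'} → b ≼ b' → (a ⇒ b) ≼ (a ⇒ b')
    ⇒-⋀     : (a : A) {I : Set ℓ} (f : I → A) → (a ⇒ ⋀ f) ≡ ⋀ (λ i → a ⇒ f i)

  ⊥ : A
  ⊥ = ⋀ (λ (a : A) → a)

  𝐊 : A
  𝐊 = ⋀ (λ (p : A × A) → let (a , b) = p in a ⇒ b ⇒ a)

  𝐒 : A
  𝐒 = ⋀ (λ (p : A × (A × A)) → let (a , (b , c)) = p in
           (a ⇒ b ⇒ c) ⇒ (a ⇒ b) ⇒ a ⇒ c)

  𝐜𝐜 : A
  𝐜𝐜 = ⋀ (λ (p : A × A) → let (a , b) = p in ((a ⇒ b) ⇒ a) ⇒ a)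

record IsSeparator {ℓ} (𝒜 : ImplicativeStructure ℓ) (S : ImplicativeStructure.A 𝒜 → Set ℓ) : Set ℓ where
  open ImplicativeStructure 𝒜
  field
    upward : ∀ {a b} → S a → a ≼ b → S b
    K∈S    : S 𝐊
    S∈S    : S 𝐒
    mp     : ∀ {a b} → S (a ⇒ b) → S a → S b

record ImplicativeAlgebra (ℓ : Level) : Set (suc ℓ) where
  field
    structure   : ImplicativeStructure ℓ
  open ImplicativeStructure structure public
  field
    Sep         : A → Set ℓ
    isSeparator : IsSeparator structure Sep

IsClassical : ∀ {ℓ} → ImplicativeAlgebra ℓ → Set ℓ
IsClassical 𝒜 = Sep 𝐜𝐜
  where open ImplicativeAlgebra 𝒜

-- Data from which an "implicative tripos" I ↦ C^I / S[I] is built: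
-- a carrier with an order, an implication and a separator.

record TriposData (ℓ : Level) : Set (suc (suc ℓ)) where
  field
    C   : Set (suc ℓ) 
    _≼_ : C → C → Set ℓ
    _⇒_ : C → C → C
    Sep : C → Set ℓ

  SepI : ∀ {i} {I : Set i} → (I → C) → Set (suc ℓ ⊔ i)
  SepI {I = I} a = Σ C (λ s → Sep s × ((x : I) → s ≼ a x))

  _⊢_ : ∀ {i} {I : Set i} → (I → C) → (I → C) → Set (suc ℓ ⊔ i)
  a ⊢ b = SepI (λ x → a x ⇒ b x)

  -- equality in the poset reflection A^I / S[I]
  _≅_ : ∀ {i} {I : Set i} → (I → C) → (I → C) → Set (suc ℓ ⊔ i)
  a ≅ b = (a ⊢ b) × (b ⊢ a)

open import Level using (Lift; lift; lower)

ImplicativeTripos : ∀ {ℓ} → ImplicativeAlgebra ℓ → TriposData ℓ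
ImplicativeTripos {ℓ} 𝒜 = record
  { C   = Lift (suc ℓ) A
  ; _≼_ = λ a b → lower a ≼ lower b
  ; _⇒_ = λ a b → lift (lower a ⇒ lower b)
  ; Sep = λ a → Sep (lower a)
  }
  where open ImplicativeAlgebra 𝒜

-- Natural isomorphism of triposes (functors Set_i^op → Pos given by
-- I ↦ C^I / S[I] with reindexing), on index sets of level i.
-- A map of quotient posets is given by a map on representatives that is
-- monotone for ⊢ (hence well defined); equalities are up to ≅.

record TriposIso {ℓ₁ ℓ₂} (i : Level) (P : TriposData ℓ₁) (Q : TriposData ℓ₂)
       : Set (suc i ⊔ suc ℓ₁ ⊔ suc ℓ₂) where
  module P = TriposData P
  module Q = TriposData Q
  field
    to      : {I : Set i} → (I → P.C) → (I → Q.C)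
    from    : {I : Set i} → (I → Q.C) → (I → P.C)
    to-mono   : {I : Set i} {a b : I → P.C} → a P.⊢ b → to a Q.⊢ to b
    from-mono : {I : Set i} {a b : I → Q.C} → a Q.⊢ b → from a P.⊢ from b
    to-from   : {I : Set i} (b : I → Q.C) → to (from b) Q.≅ b
    from-to   : {I : Set i} (a : I → P.C) → from (to a) P.≅ a
    natural   : {I J : Set i} (f : J → I) (a : I → P.C) → to (a ∘ f) Q.≅ (to a ∘ f)

record AKS (ℓ : Level) : Set (suc ℓ) where
  infixl 7 _＠_
  infixr 5 _·_
  field
    Λ   : Set ℓ
    Π   : Set ℓ
    π₀  : Π                      -- Π is nonempty (Λ is, since 𝐊 ∈ Λ)
    _＠_ : Λ → Λ → Λ
    _·_ : Λ → Π → Π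
    k_  : Π → Λ
    𝐊 𝐒 𝐜𝐜 : Λ
    PL  : Λ → Set ℓ
    PL-K  : PL 𝐊
    PL-S  : PL 𝐒
    PL-cc : PL 𝐜𝐜
    PL-app : ∀ {t u} → PL t → PL u → PL (t ＠ u)
    ⫫   : Λ → Π → Set ℓ
    ⫫-push : ∀ {t u π} → ⫫ t (u · π) → ⫫ (t ＠ u) π
    ⫫-K    : ∀ {t u π} → ⫫ t π → ⫫ 𝐊 (t · u · π)
    ⫫-S    : ∀ {t u v π} → ⫫ t (v · (u ＠ v) · π) → ⫫ 𝐒 (t · u · v · π)
    ⫫-cc   : ∀ {t π} → ⫫ t ((k π) · π) → ⫫ 𝐜𝐜 (t · π)
    ⫫-k    : ∀ {t π π'} → ⫫ t π → ⫫ (k π) (t · π')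

  𝔓Π : Set (suc ℓ)
  𝔓Π = Π → Set ℓ

  _^⫫ : 𝔓Π → Λ → Set ℓ
  (a ^⫫) t = ∀ π → a π → ⫫ t π

  _≼_ : 𝔓Π → 𝔓Π → Set ℓ
  a ≼ b = ∀ π → b π → a π

  _⇒_ : 𝔓Π → 𝔓Π → 𝔓Π
  (a ⇒ b) ρ = Σ Λ (λ t → Σ Π (λ π → (a ^⫫) t × b π × (ρ ≡ t · π)))

  Sep : 𝔓Π → Set ℓ
  Sep a = Σ Λ (λ t → PL t × (a ^⫫) t)

RealizabilityTripos : ∀ {ℓ} → AKS ℓ → TriposData ℓ
RealizabilityTripos 𝒦 = record
  { C = 𝔓Π ; _≼_ = _≼_ ; _⇒_ = _⇒_ ; Sep = Sep }
  where open AKS 𝒦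

record InducedByAKS {ℓ} (𝒜 : ImplicativeAlgebra ℓ) : Setω where
  field
    aks : AKS ℓ
    iso : (i : Level) → TriposIso i (RealizabilityTripos aks) (ImplicativeTripos 𝒜)

module Submission where

-- Following the paper, the AKS is read off 𝒜 itself:
-- terms and stacks are both elements of 𝒜, t ⫫ π means t ≼ π, a term is
-- proof-like when it lies in the separator, t · π is t ⇒ π, the application
-- t u is the least c with t ≼ u ⇒ c, and the continuation k_π is π ⇒ ⊥.
--
-- For the induced AKS, a set
-- of stacks X is compared with its meet ⋂ X: a uniform separator bound for
-- ⋂ X x ⇒ ⋂ Y x is the same as a realizability entailment X ⊢ Y.  The
-- isomorphism of triposes sends X to ⋂ X and a back to the singleton {a};
-- the theorem then only assembles these pieces.

open import Level using (Level; lift; lower)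
open import Data.Product using (Σ; _×_; _,_; proj₁)
open import Relation.Binary.PropositionalEquality using (_≡_; refl; sym; subst)
open import Relation.Binary.Structures using (IsPartialOrder)
open import Defs

module ImplicativeCalculus {ℓ : Level} (𝒜 : ImplicativeStructure ℓ) where
  open ImplicativeStructure 𝒜
  open IsPartialOrder isPartialOrder using () renaming (refl to ≼-refl; trans to ≼-trans) public

  ⊥-least : ∀ {a} → ⊥ ≼ a
  ⊥-least {a} = ⋀-lower (λ a → a) a

  ⇒-≼ : ∀ {a a' b b'} → a' ≼ a → b ≼ b' → (a ⇒ b) ≼ (a' ⇒ b')
  ⇒-≼ a'≼a b≼b' = ≼-trans (⇒-anti a'≼a) (⇒-mono b≼b')

  -- The meet of a subset X ⊆ A; it is how a set of stacks becomes an element.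
  ⋂ : (A → Set ℓ) → A
  ⋂ X = ⋀ {Σ A X} proj₁

  ⋂-lower : ∀ {X : A → Set ℓ} {a} → X a → ⋂ X ≼ a
  ⋂-lower {X} {a} a∈X = ⋀-lower {Σ A X} proj₁ (a , a∈X)

  ⋂-greatest : ∀ {X : A → Set ℓ} {c} → (∀ a → X a → c ≼ a) → c ≼ ⋂ X
  ⋂-greatest {X} {c} bound = ⋀-glb {Σ A X} proj₁ c (λ (a , a∈X) → bound a a∈X)

  ⟨_⟩ : A → A → Set ℓ
  ⟨ a ⟩ π = π ≡ a

  ⋂⟨⟩-≼ : ∀ {a} → ⋂ ⟨ a ⟩ ≼ a
  ⋂⟨⟩-≼ = ⋂-lower refl

  ≼-⋂⟨⟩ : ∀ {a} → a ≼ ⋂ ⟨ a ⟩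
  ≼-⋂⟨⟩ = ⋂-greatest (λ { _ refl → ≼-refl })

  ⇒-⋂ : ∀ (a : A) {Y : A → Set ℓ} → (a ⇒ ⋂ Y) ≡ ⋀ {Σ A Y} (λ (b , _) → a ⇒ b)
  ⇒-⋂ a {Y} = ⇒-⋀ a {Σ A Y} proj₁

  infixl 8 _＠_

  _＠_ : A → A → A
  t ＠ u = ⋂ (λ c → t ≼ (u ⇒ c))

  ＠-elim : ∀ {t u c} → t ≼ (u ⇒ c) → t ＠ u ≼ c
  ＠-elim = ⋂-lower

  -- Uses that u ⇒ _ preserves meets.
  ＠-intro : ∀ {t u} → t ≼ (u ⇒ t ＠ u)
  ＠-intro {t} {u} = subst (t ≼_) (sym (⇒-⋂ u))
    (⋀-glb _ t (λ (_ , t≼u⇒c) → t≼u⇒c))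

  -- The reduction rules of the combinators, read as inequalities; they are
  -- the anti-evaluation laws of the induced AKS.
  𝐊-rule : ∀ {t u π} → t ≼ π → 𝐊 ≼ (t ⇒ u ⇒ π)
  𝐊-rule {t} {u} t≼π = ≼-trans (⋀-lower _ (t , u)) (⇒-mono (⇒-mono t≼π))

  𝐒-rule : ∀ {t u v π} → t ≼ (v ⇒ u ＠ v ⇒ π) → 𝐒 ≼ (t ⇒ u ⇒ v ⇒ π)
  𝐒-rule {t} {u} {v} {π} t≼ =
    ≼-trans (⋀-lower _ (v , (u ＠ v , π))) (⇒-≼ t≼ (⇒-anti ＠-intro))

  𝐜𝐜-rule : ∀ {t π} → t ≼ ((π ⇒ ⊥) ⇒ π) → 𝐜𝐜 ≼ (t ⇒ π)
  𝐜𝐜-rule {t} {π} t≼ = ≼-trans (⋀-lower _ (π , ⊥)) (⇒-anti t≼)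

  continuation-rule : ∀ {t π π'} → t ≼ π → (π ⇒ ⊥) ≼ (t ⇒ π')
  continuation-rule t≼π = ⇒-≼ t≼π ⊥-least

module SeparatorFacts {ℓ : Level} (𝒜 : ImplicativeAlgebra ℓ) where
  open ImplicativeAlgebra 𝒜
  open IsSeparator isSeparator
  open ImplicativeCalculus structure

  Sep-＠ : ∀ {t u} → Sep t → Sep u → Sep (t ＠ u)
  Sep-＠ t∈S u∈S = mp (upward t∈S ＠-intro) u∈S

  𝐈 : A
  𝐈 = 𝐒 ＠ 𝐊 ＠ 𝐊

  𝐈∈Sep : Sep 𝐈
  𝐈∈Sep = Sep-＠ (Sep-＠ S∈S K∈S) K∈S

  -- 𝐈 realizes a ⇒ b whenever a ≼ b, since 𝐒 𝐊 𝐊 a reduces to a.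
  𝐈-≼ : ∀ {a b} → a ≼ b → 𝐈 ≼ (a ⇒ b)
  𝐈-≼ {a} a≼b = ≼-trans (＠-elim (＠-elim (𝐒-rule (𝐊-rule {u = 𝐊 ＠ a} ≼-refl))))
                        (⇒-mono a≼b)

  ≼⇒⊢ : ∀ {i} {I : Set i} {a b : I → TriposData.C (ImplicativeTripos 𝒜)} →
        (∀ x → lower (a x) ≼ lower (b x)) → TriposData._⊢_ (ImplicativeTripos 𝒜) a b
  ≼⇒⊢ a≼b = lift 𝐈 , 𝐈∈Sep , λ x → 𝐈-≼ (a≼b x)

module Construction {ℓ : Level} (𝒜 : ImplicativeAlgebra ℓ) (classical : IsClassical 𝒜) where
  open ImplicativeAlgebra 𝒜
  open IsSeparator isSeparator
  open ImplicativeCalculus structure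
  open SeparatorFacts 𝒜

  inducedAKS : AKS ℓ
  inducedAKS = record
    { Λ = A ; Π = A ; π₀ = ⊥ ; _＠_ = _＠_ ; _·_ = _⇒_ ; k_ = λ π → π ⇒ ⊥
    ; 𝐊 = 𝐊 ; 𝐒 = 𝐒 ; 𝐜𝐜 = 𝐜𝐜
    ; PL = Sep ; PL-K = K∈S ; PL-S = S∈S ; PL-cc = classical ; PL-app = Sep-＠
    ; ⫫ = _≼_ ; ⫫-push = ＠-elim ; ⫫-K = 𝐊-rule ; ⫫-S = 𝐒-rule
    ; ⫫-cc = 𝐜𝐜-rule ; ⫫-k = continuation-rule }

  module P = TriposData (RealizabilityTripos inducedAKS)
  module Q = TriposData (ImplicativeTripos 𝒜)

  -- An entailment of families of sets of stacks, transported to their meets: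
  -- a single element of the separator below every ⋂ X x ⇒ ⋂ Y x.
  MeetBound : ∀ {i} {I : Set i} (X Y : I → A → Set ℓ) → Set _
  MeetBound {I = I} X Y = Σ A (λ s → Sep s × ((x : I) → s ≼ (⋂ (X x) ⇒ ⋂ (Y x))))

  -- A bound s realizes every t · π of X x ⇒ Y x: such a t lies below ⋂ X x
  -- and π above ⋂ Y x.  The realizability witness is the upset of s.
  meetBound⇒⊢ : ∀ {i} {I : Set i} {X Y : I → A → Set ℓ} → MeetBound X Y → X P.⊢ Y
  meetBound⇒⊢ (s , s∈S , s≼) =
    (λ ρ → s ≼ ρ) , (s , s∈S , λ _ s≼ρ → s≼ρ) ,
    λ { x _ (t , π , t⊩X , π∈Y , refl) →
          ≼-trans (s≼ x) (⇒-≼ (⋂-greatest t⊩X) (⋂-lower π∈Y)) }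

  -- Conversely a proof-like realizer t of X ⊢ Y realizes ⋂ X x ⇒ π for each
  -- π ∈ Y x, because ⋂ X x is a term below all of X x.
  ⊢⇒meetBound : ∀ {i} {I : Set i} {X Y : I → A → Set ℓ} → X P.⊢ Y → MeetBound X Y
  ⊢⇒meetBound {X = X} {Y} (_ , (t , t∈S , t⊩) , realized) = t , t∈S , λ x →
    subst (t ≼_) (sym (⇒-⋂ (⋂ (X x))))
      (⋀-glb _ t (λ (π , π∈Y) →
        t⊩ _ (realized x _ (⋂ (X x) , π , (λ _ → ⋂-lower) , π∈Y , refl))))

  ⋂-≼⇒⊢ : ∀ {i} {I : Set i} {X Y : I → A → Set ℓ} →
          (∀ x → ⋂ (X x) ≼ ⋂ (Y x)) → X P.⊢ Y
  ⋂-≼⇒⊢ ⋂X≼⋂Y = meetBound⇒⊢ (𝐈 , 𝐈∈Sep , λ x → 𝐈-≼ (⋂X≼⋂Y x))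

  iso : (i : Level) → TriposIso i (RealizabilityTripos inducedAKS) (ImplicativeTripos 𝒜)
  iso i = record
    { to = λ X x → lift (⋂ (X x))
    ; from = λ a x → ⟨ lower (a x) ⟩
    ; to-mono = λ X⊢Y → let (s , s∈S , s≼) = ⊢⇒meetBound X⊢Y in lift s , s∈S , s≼
    ; from-mono = λ (s , s∈S , s≼) →
        meetBound⇒⊢ (lower s , s∈S , λ x → ≼-trans (s≼ x) (⇒-≼ ⋂⟨⟩-≼ ≼-⋂⟨⟩))
    ; to-from = λ a → ≼⇒⊢ (λ x → ⋂⟨⟩-≼) , ≼⇒⊢ (λ x → ≼-⋂⟨⟩)
    ; from-to = λ X → ⋂-≼⇒⊢ (λ x → ⋂⟨⟩-≼) , ⋂-≼⇒⊢ (λ x → ≼-⋂⟨⟩)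
    ; natural = λ f X → ≼⇒⊢ (λ x → ≼-refl) , ≼⇒⊢ (λ x → ≼-refl)
    }

theorem4p19 : {ℓ : Level} (𝒜 : ImplicativeAlgebra ℓ) → IsClassical 𝒜 → InducedByAKS 𝒜
theorem4p19 𝒜 classical = record
  { aks = Construction.inducedAKS 𝒜 classical
  ; iso = Construction.iso 𝒜 classical
  }
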